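{- Let $q$ be a prime power, $r\ge1$, view $AG(r-1,q)$ as $PG(r-1,q)\backslash H$ for a projective hyperplane $H=E(PG(r-1,q))-E(AG(r-1,q))$, and let $\operatorname{cl}_P$ denote closure in $PG(r-1,q)$. Let $(G,R)$ be a $2$-coloring of $AG(r-1,q)$ such that $G$ is the union of the sets $F_{i+1}-F_i$ over all even $i$, for a nested sequence $(F_0,\dots,F_k)$ of affine flats. Then $(\operatorname{cl}_P(F_0),\operatorname{cl}_P(F_1),\dots,\operatorname{cl}_P(F_k))$ is a nested sequence of projective flats, and if $G_P$ is the union of the sets $\operatorname{cl}_P(F_{i+1})-\operatorname{cl}_P(F_i)$ over all even $i$ (so $PG(r-1,q)|G_P$ is a projective target), then $PG(r-1,q)|(G_P-H)\cong AG(r-1,q)|G$.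
   Context: $PG(r-1,q)$ and $AG(r-1,q)$ denote the rank-$r$ projective and affine geometries over $GF(q)$. A $2$-coloring $(G,R)$ is a partition of the ground set into possibly empty sets $G$ and $R$. A nested sequence of affine (respectively projective) flats is a sequence $(F_0,\dots,F_k)$ of possibly empty affine (respectively projective) flats with $\emptyset=F_0\subseteq\dots\subseteq F_k$ equal to the whole ground set; sums "over even $i$" range over $0\le i\le k-1$. A projective target is $PG(r-1,q)|X$ where $X$ is such a union for a nested sequence of projective flats. -}

module Defs where

open import Data.Nat using (ℕ; zero; suc; _+_; _^_; _<_; _≤_; _%_)
open import Data.Nat.Primality using (Prime)
open import Data.Fin using (Fin)
open import Data.Vec using (Vec; []; _∷_; replicate; zipWith)
open import Data.List using (List; []; _∷_; map; length)
open import Data.List.Relation.Unary.All using (All)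
open import Data.Bool using (Bool; true; false; T; if_then_else_)
open import Data.Product using (Σ; ∃; _×_; _,_; proj₁; proj₂)
open import Data.Sum using (_⊎_)
open import Relation.Nullary using (¬_; Dec; does)
open import Relation.Binary.PropositionalEquality using (_≡_; _≢_)
open import Algebra.Structures using (IsCommutativeRing)
open import Function.Bundles using (_↔_; _⇔_)

IsPrimePower : ℕ → Set
IsPrimePower q = Σ ℕ λ p → Σ ℕ λ k → Prime p × q ≡ p ^ suc k

record FiniteField (q : ℕ) : Set₁ where
  field
    Carrier : Set
    _+F_ _*F_ : Carrier → Carrier → Carrier
    -F_ : Carrier → Carrier
    0F 1F : Carrier
    isCommutativeRing : IsCommutativeRing _≡_ _+F_ _*F_ -F_ 0F 1F
    0≢1 : 0F ≢ 1F
    inverse : ∀ x → x ≢ 0F → Σ Carrier λ y → x *F y ≡ 1F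
    _≟F_ : (x y : Carrier) → Dec (x ≡ y)
    enumeration : Fin q ↔ Carrier

module Geometry {q : ℕ} (𝔽 : FiniteField q) (r : ℕ) where
  open FiniteField 𝔽

  isNormalized : ∀ {n} → Vec Carrier n → Bool
  isNormalized [] = false
  isNormalized (x ∷ xs) = if does (x ≟F 0F) then isNormalized xs else does (x ≟F 1F)

  -- points of PG(r-1,q): one-dimensional subspaces of GF(q)^r, each
  -- represented by its unique normalized spanning vector
  Point : Set
  Point = Σ (Vec Carrier r) λ v → T (isNormalized v)

  vec : Point → Vec Carrier r
  vec = proj₁

  Subset : Set₁
  Subset = Point → Set

  _⊆_ : Subset → Subset → Set
  A ⊆ B = ∀ p → A p → B p

  _≐_ : Subset → Subset → Set
  A ≐ B = ∀ p → (A p ⇔ B p)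

  zeroV : Vec Carrier r
  zeroV = replicate r 0F

  _⊕_ : Vec Carrier r → Vec Carrier r → Vec Carrier r
  _⊕_ = zipWith _+F_

  _·_ : Carrier → Vec Carrier r → Vec Carrier r
  c · v = Data.Vec.map (c *F_) v

  linComb : List (Carrier × Point) → Vec Carrier r
  linComb [] = zeroV
  linComb ((c , p) ∷ xs) = (c · vec p) ⊕ linComb xs

  cl : Subset → Subset
  cl X p = Σ (List (Carrier × Point)) λ xs →
             All (λ cp → X (proj₂ cp)) xs × linComb xs ≡ vec p

  Independent : List Point → Set
  Independent ps = (cs : List Carrier) → length cs ≡ length ps →
    linComb (Data.List.zipWith _,_ cs ps) ≡ zeroV → All (_≡ 0F) cs

  IsFlat : Subset → Set
  IsFlat X = cl X ⊆ X

  -- projective hyperplanes: maximal proper flats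
  IsHyperplane : Subset → Set
  IsHyperplane H = IsFlat H × (Σ Point λ p → ¬ H p) ×
    (∀ e → ¬ H e → ∀ p → cl (λ x → H x ⊎ x ≡ e) p)

  -- affine geometry AG(r-1,q) = PG(r-1,q) \ H ; its closure is cl_P intersected with E - H
  module Affine (H : Subset) where
    InAG : Subset
    InAG p = ¬ H p

    IsAffineFlat : Subset → Set
    IsAffineFlat X = X ⊆ InAG × (∀ p → InAG p → cl X p → X p)

    NestedAffine : ℕ → (ℕ → Subset) → Set
    NestedAffine k F = (∀ i → i ≤ k → IsAffineFlat (F i)) × (∀ p → ¬ F 0 p)
      × (∀ i → i < k → F i ⊆ F (suc i)) × (F k ≐ InAG)

  NestedProjective : ℕ → (ℕ → Subset) → Set
  NestedProjective k F = (∀ i → i ≤ k → IsFlat (F i)) × (∀ p → ¬ F 0 p)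
    × (∀ i → i < k → F i ⊆ F (suc i)) × (∀ p → F k p)

  EvenUnion : ℕ → (ℕ → Subset) → Subset
  EvenUnion k F p = Σ ℕ λ i → i % 2 ≡ 0 × i < k × F (suc i) p × ¬ F i p

  -- isomorphism of restrictions PG|A ≅ PG|B (AG|G is PG|G as AG = PG|(E - H))
  RestrictionIso : Subset → Subset → Set
  RestrictionIso A B =
    Σ ((Σ Point A) → (Σ Point B)) λ f →
    Σ ((Σ Point B) → (Σ Point A)) λ g →
      (∀ x → proj₁ (g (f x)) ≡ proj₁ x) × (∀ y → proj₁ (f (g y)) ≡ proj₁ y)
      × (∀ (xs : List (Σ Point A)) →
           Independent (map proj₁ xs) ⇔ Independent (map (λ x → proj₁ (f x)) xs))

{-# OPTIONS --safe #-}
-- A point off H lies in cl_P(F) exactly when it lies in the affine flat F, so closing every F i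
-- changes nothing outside H: the two colourings agree on E − H and the isomorphism is the
-- identity. The closures form a nested sequence of projective flats because cl_P is monotone and
-- idempotent; the last one is everything because the complement of a hyperplane spans: for e ∉ H
-- and h ∈ H, the point w spanned by e + h lies off H, and h is a combination of w and e.
module Submission where

open import Defs
open import Data.Nat using (ℕ; _≥_; zero; suc; _≤_)
open import Data.Nat.Properties using (<⇒≤)
open import Data.Product using (_×_; Σ; _,_; proj₁; proj₂)
open import Data.Sum using (_⊎_; inj₁; inj₂)
open import Data.Empty using (⊥-elim)
open import Data.Unit using (tt)
open import Data.Bool using (true; false; T)
open import Data.Vec using (Vec; []; _∷_; replicate; zipWith)
import Data.Vec as Vec
open import Data.Vec.Properties
  using (zipWith-assoc; zipWith-comm; zipWith-identityˡ; zipWith-identityʳ; zipWith-inverseʳ;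
         map-∘; map-cong; map-id; map-replicate)
open import Data.List using (List; []; _∷_; _++_; map)
open import Data.List.Relation.Unary.All using (All; []; _∷_)
import Data.List.Relation.Unary.All as All
open import Data.List.Relation.Unary.All.Properties using (++⁺; map⁺)
open import Relation.Nullary using (¬_; yes; no)
open import Relation.Binary.PropositionalEquality
open import Function using (id; _∘_; _∘′_)
open import Function.Bundles using (mk⇔; Equivalence)
open import Function.Construct.Composition using (_⇔-∘_)
open import Function.Construct.Symmetry using (⇔-sym)
open import Algebra.Bundles using (Ring)
import Algebra.Properties.Ring as RingProperties
open import Algebra.Structures using (IsCommutativeRing)

-- At length r these are definitionally Geometry's _⊕_, _·_ and zeroV; the length is left
-- free because normalize recurses on it.
module Vectors {q : ℕ} (𝔽 : FiniteField q) where
  open FiniteField 𝔽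
  open IsCommutativeRing isCommutativeRing hiding (refl; sym; trans)

  private
    ring : Ring _ _
    ring = record { isRing = isRing }
  open RingProperties ring using (-1*x≈-x)

  0ᵥ : ∀ {n} → Vec Carrier n
  0ᵥ = replicate _ 0F

  _+ᵥ_ : ∀ {n} → Vec Carrier n → Vec Carrier n → Vec Carrier n
  _+ᵥ_ = zipWith _+F_

  _*ᵥ_ : ∀ {n} → Carrier → Vec Carrier n → Vec Carrier n
  c *ᵥ v = Vec.map (c *F_) v

  infixl 6 _+ᵥ_
  infixr 7 _*ᵥ_

  +ᵥ-assoc : ∀ {n} (u v w : Vec Carrier n) → (u +ᵥ v) +ᵥ w ≡ u +ᵥ (v +ᵥ w)
  +ᵥ-assoc = zipWith-assoc +-assoc

  +ᵥ-comm : ∀ {n} (u v : Vec Carrier n) → u +ᵥ v ≡ v +ᵥ u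
  +ᵥ-comm = zipWith-comm +-comm

  +ᵥ-identityˡ : ∀ {n} (v : Vec Carrier n) → 0ᵥ +ᵥ v ≡ v
  +ᵥ-identityˡ = zipWith-identityˡ +-identityˡ

  +ᵥ-identityʳ : ∀ {n} (v : Vec Carrier n) → v +ᵥ 0ᵥ ≡ v
  +ᵥ-identityʳ = zipWith-identityʳ +-identityʳ

  *ᵥ-identityˡ : ∀ {n} (v : Vec Carrier n) → 1F *ᵥ v ≡ v
  *ᵥ-identityˡ v = trans (map-cong *-identityˡ v) (map-id v)

  *ᵥ-assoc : ∀ {n} c d (v : Vec Carrier n) → (c *F d) *ᵥ v ≡ c *ᵥ d *ᵥ v
  *ᵥ-assoc c d v = trans (map-cong (*-assoc c d) v) (map-∘ (c *F_) (d *F_) v)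

  *ᵥ-zeroʳ : ∀ {n} c → c *ᵥ 0ᵥ {n} ≡ 0ᵥ
  *ᵥ-zeroʳ {n} c = trans (map-replicate (c *F_) 0F n) (cong (replicate n) (zeroʳ c))

  *ᵥ-distribˡ : ∀ {n} c (u v : Vec Carrier n) → c *ᵥ (u +ᵥ v) ≡ c *ᵥ u +ᵥ c *ᵥ v
  *ᵥ-distribˡ c [] [] = refl
  *ᵥ-distribˡ c (a ∷ u) (b ∷ v) = cong₂ _∷_ (distribˡ c a b) (*ᵥ-distribˡ c u v)

  +ᵥ-cancelʳ : ∀ {n} (u w : Vec Carrier n) → (u +ᵥ w) +ᵥ (-F 1F) *ᵥ w ≡ u
  +ᵥ-cancelʳ u w = begin
    (u +ᵥ w) +ᵥ (-F 1F) *ᵥ w     ≡⟨ +ᵥ-assoc u w _ ⟩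
    u +ᵥ (w +ᵥ (-F 1F) *ᵥ w)     ≡⟨ cong (λ x → u +ᵥ (w +ᵥ x)) (map-cong -1*x≈-x w) ⟩
    u +ᵥ (w +ᵥ Vec.map -F_ w)    ≡⟨ cong (u +ᵥ_) (zipWith-inverseʳ -‿inverseʳ w) ⟩
    u +ᵥ 0ᵥ                      ≡⟨ +ᵥ-identityʳ u ⟩
    u                            ∎
    where open ≡-Reasoning

module Projective {q : ℕ} (𝔽 : FiniteField q) (r : ℕ) where
  open FiniteField 𝔽
  open IsCommutativeRing isCommutativeRing using (*-identityʳ; zeroʳ)
  open Vectors 𝔽
  open Geometry 𝔽 r

  isNormalized-0∷ : ∀ {n} (w : Vec Carrier n) → isNormalized (0F ∷ w) ≡ isNormalized w
  isNormalized-0∷ w with 0F ≟F 0F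
  ... | yes _   = refl
  ... | no 0≢0 = ⊥-elim (0≢0 refl)

  isNormalized-1∷ : ∀ {n} (w : Vec Carrier n) → isNormalized (1F ∷ w) ≡ true
  isNormalized-1∷ w with 1F ≟F 0F | 1F ≟F 1F
  ... | yes 1≡0 | _       = ⊥-elim (0≢1 (sym 1≡0))
  ... | no _    | yes _   = refl
  ... | no _    | no 1≢1 = ⊥-elim (1≢1 refl)

  isNormalized-0ᵥ : ∀ n → isNormalized (0ᵥ {n}) ≡ false
  isNormalized-0ᵥ zero    = refl
  isNormalized-0ᵥ (suc n) = trans (isNormalized-0∷ (0ᵥ {n})) (isNormalized-0ᵥ n)

  vec≢zeroV : ∀ p → vec p ≢ zeroV
  vec≢zeroV (v , normalized) v≡0 =
    subst T (isNormalized-0ᵥ r) (subst (T ∘′ isNormalized) v≡0 normalized)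

  normalize : ∀ {n} (v : Vec Carrier n) → v ≢ 0ᵥ →
    Σ Carrier λ c → Σ (Vec Carrier n) λ w → T (isNormalized w) × c *ᵥ w ≡ v
  normalize []       v≢0 = ⊥-elim (v≢0 refl)
  normalize (x ∷ xs) v≢0 with x ≟F 0F
  ... | yes refl =
    let c , w , normalized , eq = normalize xs (v≢0 ∘ cong (0F ∷_))
    in  c , 0F ∷ w , subst T (sym (isNormalized-0∷ w)) normalized , cong₂ _∷_ (zeroʳ c) eq
  ... | no x≢0 =
    let y , xy≡1 = inverse x x≢0
    in  x , 1F ∷ y *ᵥ xs , subst T (sym (isNormalized-1∷ (y *ᵥ xs))) tt ,
        cong₂ _∷_ (*-identityʳ x) (begin
          x *ᵥ y *ᵥ xs   ≡⟨ sym (*ᵥ-assoc x y xs) ⟩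
          (x *F y) *ᵥ xs ≡⟨ cong (_*ᵥ xs) xy≡1 ⟩
          1F *ᵥ xs       ≡⟨ *ᵥ-identityˡ xs ⟩
          xs             ∎)
    where open ≡-Reasoning

  linComb-++ : ∀ xs ys → linComb (xs ++ ys) ≡ linComb xs +ᵥ linComb ys
  linComb-++ []             ys = sym (+ᵥ-identityˡ (linComb ys))
  linComb-++ ((c , p) ∷ xs) ys =
    trans (cong (c *ᵥ vec p +ᵥ_) (linComb-++ xs ys)) (sym (+ᵥ-assoc _ _ _))

  scaleCoefficients : Carrier → List (Carrier × Point) → List (Carrier × Point)
  scaleCoefficients c = map (λ (d , p) → c *F d , p)

  linComb-scale : ∀ c xs → linComb (scaleCoefficients c xs) ≡ c *ᵥ linComb xs
  linComb-scale c []             = sym (*ᵥ-zeroʳ c)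
  linComb-scale c ((d , p) ∷ xs) =
    trans (cong₂ _+ᵥ_ (*ᵥ-assoc c d (vec p)) (linComb-scale c xs)) (sym (*ᵥ-distribˡ c _ _))

  linComb-pair : ∀ c p d p′ → linComb ((c , p) ∷ (d , p′) ∷ []) ≡ c *ᵥ vec p +ᵥ d *ᵥ vec p′
  linComb-pair c p d p′ = cong (c *ᵥ vec p +ᵥ_) (+ᵥ-identityʳ (d *ᵥ vec p′))

  cl-monotone : ∀ {X Y} → X ⊆ Y → cl X ⊆ cl Y
  cl-monotone X⊆Y p (xs , inX , eq) = xs , All.map (X⊆Y _) inX , eq

  ⊆-cl : ∀ X → X ⊆ cl X
  ⊆-cl X p Xp =
    (1F , p) ∷ [] , Xp ∷ [] , trans (+ᵥ-identityʳ (1F *ᵥ vec p)) (*ᵥ-identityˡ (vec p))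

  cl-isFlat : ∀ X → IsFlat (cl X)
  cl-isFlat X p (xs , inClX , eq) =
    let ys , inX , eq′ = expand xs inClX in ys , inX , trans eq′ eq
    where
    expand : ∀ xs → All (λ cp → cl X (proj₂ cp)) xs →
      Σ (List (Carrier × Point)) λ ys → All (λ cp → X (proj₂ cp)) ys × linComb ys ≡ linComb xs
    expand []             []                      = [] , [] , refl
    expand ((c , p) ∷ xs) ((ys , inX , eq) ∷ rest) =
      let zs , inX′ , eq′ = expand xs rest
      in  scaleCoefficients c ys ++ zs , ++⁺ (map⁺ inX) inX′ ,
          trans (linComb-++ (scaleCoefficients c ys) zs)
                (cong₂ _+ᵥ_ (trans (linComb-scale c ys) (cong (c *ᵥ_) eq)) eq′)

  cl-empty : ∀ X → (∀ p → ¬ X p) → ∀ p → ¬ cl X p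
  cl-empty X empty p ([]          , []     , eq) = vec≢zeroV p (sym eq)
  cl-empty X empty p ((_ , x) ∷ _ , Xx ∷ _ , _)  = empty x Xx

  H⊆cl-complement : ∀ {H} → IsHyperplane H → ∀ h → H h → cl (λ x → ¬ H x) h
  H⊆cl-complement {H} (H-flat , (e , e∉H) , _) h h∈H with normalize (vec e +ᵥ vec h) e+h≢0
    where
    e+h≢0 : vec e +ᵥ vec h ≢ 0ᵥ
    e+h≢0 e+h≡0 = e∉H (H-flat e ((-F 1F , h) ∷ [] , h∈H ∷ [] , (begin
      (-F 1F) *ᵥ vec h +ᵥ 0ᵥ                ≡⟨ +ᵥ-identityʳ _ ⟩
      (-F 1F) *ᵥ vec h                      ≡⟨ sym (+ᵥ-identityˡ _) ⟩
      0ᵥ +ᵥ (-F 1F) *ᵥ vec h                ≡⟨ cong (_+ᵥ (-F 1F) *ᵥ vec h) (sym e+h≡0) ⟩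
      (vec e +ᵥ vec h) +ᵥ (-F 1F) *ᵥ vec h  ≡⟨ +ᵥ-cancelʳ (vec e) (vec h) ⟩
      vec e                                 ∎)))
      where open ≡-Reasoning
  ... | c , v , normalized , cw≡e+h =
    (c , w) ∷ (-F 1F , e) ∷ [] , w∉H ∷ e∉H ∷ [] , (begin
      linComb ((c , w) ∷ (-F 1F , e) ∷ [])  ≡⟨ linComb-pair c w (-F 1F) e ⟩
      c *ᵥ vec w +ᵥ (-F 1F) *ᵥ vec e        ≡⟨ cong (_+ᵥ (-F 1F) *ᵥ vec e) cw≡h+e ⟩
      (vec h +ᵥ vec e) +ᵥ (-F 1F) *ᵥ vec e  ≡⟨ +ᵥ-cancelʳ (vec h) (vec e) ⟩
      vec h                                 ∎)
    where
    open ≡-Reasoning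
    w : Point
    w = v , normalized
    cw≡h+e : c *ᵥ vec w ≡ vec h +ᵥ vec e
    cw≡h+e = trans cw≡e+h (+ᵥ-comm (vec e) (vec h))
    w∉H : ¬ H w
    w∉H w∈H = e∉H (H-flat e ((c , w) ∷ (-F 1F , h) ∷ [] , w∈H ∷ h∈H ∷ [] ,
      trans (linComb-pair c w (-F 1F) h)
            (trans (cong (_+ᵥ (-F 1F) *ᵥ vec h) cw≡e+h) (+ᵥ-cancelʳ (vec e) (vec h)))))

  hyperplane-complement-spans : ∀ {H} → IsHyperplane H → ∀ p → cl (λ x → ¬ H x) p
  hyperplane-complement-spans {H} hyperplane@(_ , (e , e∉H) , H+e-spans) p =
    cl-isFlat _ p (cl-monotone H+e⊆cl-complement p (H+e-spans e e∉H p))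
    where
    H+e⊆cl-complement : (λ x → H x ⊎ x ≡ e) ⊆ cl (λ x → ¬ H x)
    H+e⊆cl-complement x (inj₁ x∈H)  = H⊆cl-complement hyperplane x x∈H
    H+e⊆cl-complement x (inj₂ refl) = ⊆-cl _ x e∉H

  RestrictionIso-≐ : ∀ {A B} → A ≐ B → RestrictionIso A B
  RestrictionIso-≐ A≐B =
    (λ (p , Ap) → p , Equivalence.to (A≐B p) Ap) ,
    (λ (p , Bp) → p , Equivalence.from (A≐B p) Bp) ,
    (λ _ → refl) , (λ _ → refl) , (λ _ → mk⇔ id id)

  module AffineClosure (H : Subset) where
    open Affine H

    NestedAffine⇒NestedProjective-cl : ∀ {k F} → (∀ p → cl InAG p) →
      NestedAffine k F → NestedProjective k (λ i → cl (F i))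
    NestedAffine⇒NestedProjective-cl {F = F} InAG-spans (_ , F₀-empty , F-nested , Fₖ≐InAG) =
      (λ i _ → cl-isFlat (F i)) , cl-empty (F 0) F₀-empty ,
      (λ i i<k → cl-monotone (F-nested i i<k)) ,
      (λ p → cl-monotone (λ x → Equivalence.from (Fₖ≐InAG x)) p (InAG-spans p))

    EvenUnion-cl-InAG : ∀ {k F} → NestedAffine k F →
      (λ p → EvenUnion k (λ i → cl (F i)) p × InAG p) ≐ EvenUnion k F
    EvenUnion-cl-InAG {k} {F} (F-flat , _) p = mk⇔ to from
      where
      clF⊆F : ∀ {i} → i ≤ k → InAG p → cl (F i) p → F i p
      clF⊆F i≤k = proj₂ (F-flat _ i≤k) p

      to : EvenUnion k (λ i → cl (F i)) p × InAG p → EvenUnion k F p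
      to ((i , even , i<k , p∈clF₁₊ᵢ , p∉clFᵢ) , p∈AG) =
        i , even , i<k , clF⊆F i<k p∈AG p∈clF₁₊ᵢ , p∉clFᵢ ∘ ⊆-cl (F i) p

      from : EvenUnion k F p → EvenUnion k (λ i → cl (F i)) p × InAG p
      from (i , even , i<k , p∈F₁₊ᵢ , p∉Fᵢ) =
        (i , even , i<k , ⊆-cl (F (suc i)) p p∈F₁₊ᵢ , p∉Fᵢ ∘ clF⊆F (<⇒≤ i<k) p∈AG) , p∈AG
        where
        p∈AG : InAG p
        p∈AG = proj₁ (F-flat (suc i) i<k) p p∈F₁₊ᵢ

proposition4p9 : (q : ℕ) → IsPrimePower q → (𝔽 : FiniteField q) → (r : ℕ) → r ≥ 1 → let open Geometry 𝔽 r in (H : Subset) → IsHyperplane H → let open Affine H in (G : Subset) → (k : ℕ) → (F : ℕ → Subset) → NestedAffine k F → G ≐ EvenUnion k F → NestedProjective k (λ i → cl (F i)) × RestrictionIso (λ p → EvenUnion k (λ i → cl (F i)) p × ¬ H p) G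
proposition4p9 q _ 𝔽 r _ H hyperplane G k F F-nested G≐EvenUnion =
  NestedAffine⇒NestedProjective-cl (hyperplane-complement-spans hyperplane) F-nested ,
  RestrictionIso-≐ (λ p → ⇔-sym (G≐EvenUnion p) ⇔-∘ EvenUnion-cl-InAG F-nested p)
  where
  open Projective 𝔽 r
  open AffineClosure H
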